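{- Every cubic ($3$-regular) simple graph $G$ of order $6$ satisfies $d_{\rm st}(G)=3$. (There are exactly two such graphs: $K_{3,3}$ and the triangular prism $K_3\square K_2$.)
   Context: For a finite simple graph $G=(V,E)$, a set $D\subseteq V$ is a strong dominating set if for every vertex $x\in V\setminus D$ there is a vertex $y\in D$ with $xy\in E$ and $\deg(x)\le \deg(y)$. A strong domatic partition of $G$ is a partition of $V(G)$ all of whose classes are strong dominating sets of $G$. The strong domatic number $d_{\rm st}(G)$ is the maximum number of classes of a strong domatic partition of $G$. -}

module Defs where

open import Data.Nat using (ℕ; _≤_)
open import Data.Bool using (Bool; true; false; if_then_else_)
open import Data.Fin using (Fin)
open import Data.List using (map; allFin)
open import Data.Nat.ListAction using (sum)
open import Relation.Nullary using (¬_)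
open import Data.Product using (Σ; ∃; _×_)
open import Relation.Binary.PropositionalEquality using (_≡_; _≢_)

record SimpleGraph (n : ℕ) : Set where
  field
    adj     : Fin n → Fin n → Bool
    symm    : ∀ x y → adj x y ≡ adj y x
    irrefl  : ∀ x → adj x x ≡ false
open SimpleGraph public

degree : ∀ {n} → SimpleGraph n → Fin n → ℕ
degree {n} G v = sum (map (λ u → if adj G v u then 1 else 0) (allFin n))

Cubic : ∀ {n} → SimpleGraph n → Set
Cubic {n} G = ∀ (v : Fin n) → degree G v ≡ 3

IsStrongDominating : ∀ {n} → SimpleGraph n → (Fin n → Set) → Set
IsStrongDominating {n} G D =
  ∀ (x : Fin n) → ¬ D x →
    Σ (Fin n) λ y → D y × (adj G x y ≡ true) × (degree G x ≤ degree G y)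

IsStrongDomaticPartition : ∀ {n} → SimpleGraph n → (k : ℕ) → (Fin n → Fin k) → Set
IsStrongDomaticPartition {n} G k c =
  ∀ (i : Fin k) →
    (Σ (Fin n) λ v → c v ≡ i) × IsStrongDominating G (λ v → c v ≡ i)

HasStrongDomaticPartition : ∀ {n} → SimpleGraph n → ℕ → Set
HasStrongDomaticPartition {n} G k =
  Σ (Fin n → Fin k) λ c → IsStrongDomaticPartition G k c

StrongDomaticNumber≡ : ∀ {n} → SimpleGraph n → ℕ → Set
StrongDomaticNumber≡ G d =
  HasStrongDomaticPartition G d × (∀ k → HasStrongDomaticPartition G k → k ≤ d)

-- A vertex forming a strong dominating set on its own is adjacent to every other vertex.
-- In a cubic graph of order 6 no vertex is, so every class of a strong domatic partition
-- has two vertices and there are at most three classes. Conversely, every cubic graph of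
-- order 6 (the prism or K_{3,3}) has a perfect matching whose three pairs are strong
-- dominating sets; this is checked exhaustively over all graphs on six labelled vertices.
module Submission where

open import Defs
open import Data.Bool using (Bool; true; false; if_then_else_)
import Data.Bool.Properties as Bool
open import Data.Unit using (⊤; tt)
open import Data.Nat using (ℕ; zero; suc; _≤_; _∸_; _+_; z≤n; s≤s)
import Data.Nat.Properties as ℕ
open import Data.Fin using (Fin; zero; suc; _≟_; splitAt; join; #_)
open import Data.Fin.Properties using (all?; any?; suc-injective; injective⇒≤; join-splitAt)
open import Data.Vec using (Vec; []; _∷_; lookup)
import Data.Vec as Vec
open import Data.Vec.Properties using (lookup∘tabulate)
open import Data.List using (List; []; _∷_; allFin; tabulate)
open import Data.List.Properties using (map-cong; map-tabulate)
open import Data.List.Relation.Unary.Any using (Any; satisfied)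
import Data.List.Relation.Unary.Any as Any
open import Data.Nat.ListAction using (sum)
open import Data.Product using (∃; _×_; _,_; proj₁; proj₂; uncurry)
open import Data.Sum using (_⊎_; inj₁; inj₂; [_,_])
open import Function using (_∘_; id)
open import Relation.Nullary using (Dec; yes; no; contradiction)
open import Relation.Nullary.Decidable using (map′; toWitness; _×-dec_; _→-dec_; ¬?; decidable-stable)
open import Relation.Unary using (Decidable)
open import Relation.Binary.PropositionalEquality using (_≡_; _≢_; refl; sym; trans; cong; subst₂; ≢-sym)

record SameEdges {n} (G H : SimpleGraph n) : Set where
  field same-adj : ∀ x y → adj G x y ≡ adj H x y
open SameEdges

sameEdges-sym : ∀ {n} {G H : SimpleGraph n} → SameEdges G H → SameEdges H G
same-adj (sameEdges-sym e) x y = sym (same-adj e x y)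

degree-cong : ∀ {n} {G H : SimpleGraph n} → SameEdges G H → ∀ v → degree G v ≡ degree H v
degree-cong e v = cong sum (map-cong (λ u → cong (λ b → if b then 1 else 0) (same-adj e v u)) (allFin _))

cubic-resp : ∀ {n} {G H : SimpleGraph n} → SameEdges G H → Cubic G → Cubic H
cubic-resp e cub v = trans (sym (degree-cong e v)) (cub v)

strongDominating-resp : ∀ {n} {G H : SimpleGraph n} {D : Fin n → Set} → SameEdges G H →
  IsStrongDominating G D → IsStrongDominating H D
strongDominating-resp e dom x x∉D with dom x x∉D
... | y , y∈D , xy , deg≤ = y , y∈D , trans (sym (same-adj e x y)) xy ,
  subst₂ _≤_ (degree-cong e x) (degree-cong e y) deg≤

strongDomaticPartition-resp : ∀ {n k} {G H : SimpleGraph n} {c : Fin n → Fin k} →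
  SameEdges G H → IsStrongDomaticPartition G k c → IsStrongDomaticPartition H k c
strongDomaticPartition-resp e p i = proj₁ (p i) , strongDominating-resp e (proj₂ (p i))

sum-indicator-true : ∀ {m} (f : Fin m → Bool) → (∀ u → f u ≡ true) →
  sum (tabulate (λ u → if f u then 1 else 0)) ≡ m
sum-indicator-true {zero}  f all = refl
sum-indicator-true {suc m} f all rewrite all zero =
  cong suc (sum-indicator-true (f ∘ suc) (all ∘ suc))

sum-indicator-true-except : ∀ {m} (f : Fin m → Bool) v → f v ≡ false →
  (∀ u → u ≢ v → f u ≡ true) → sum (tabulate (λ u → if f u then 1 else 0)) ≡ m ∸ 1
sum-indicator-true-except {suc m} f zero fv all rewrite fv =
  sum-indicator-true (f ∘ suc) (λ u → all (suc u) λ ())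
sum-indicator-true-except {suc (suc m)} f (suc v) fv all rewrite all zero (λ ()) =
  cong suc (sum-indicator-true-except (f ∘ suc) v fv (λ u u≢v → all (suc u) (u≢v ∘ suc-injective)))

degree-universal : ∀ {n} (G : SimpleGraph n) v → (∀ u → u ≢ v → adj G v u ≡ true) →
  degree G v ≡ n ∸ 1
degree-universal G v adjacent = trans
  (cong sum (map-tabulate id (λ u → if adj G v u then 1 else 0)))
  (sum-indicator-true-except (adj G v) v (irrefl G v) adjacent)

strongDominating-singleton⇒universal : ∀ {n} (G : SimpleGraph n) {D : Fin n → Set} {r} →
  IsStrongDominating G D → (∀ u → D u → u ≡ r) → ∀ x → x ≢ r → adj G r x ≡ true
strongDominating-singleton⇒universal G dom D⊆r x x≢r with dom x (x≢r ∘ D⊆r x)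
... | y , y∈D , xy , _ with D⊆r y y∈D
... | refl = trans (symm G _ x) xy

record TwoMembers {n k} (c : Fin n → Fin k) (i : Fin k) : Set where
  field
    first second : Fin n
    first∈  : c first ≡ i
    second∈ : c second ≡ i
    distinct : first ≢ second

class-twoMembers : ∀ {n k} {c : Fin n → Fin k} (G : SimpleGraph n) →
  (∀ v → degree G v ≢ n ∸ 1) → IsStrongDomaticPartition G k c → ∀ i → TwoMembers c i
class-twoMembers {c = c} G notUniversal partition i
  with partition i
... | (r , r∈) , dom with any? (λ s → (c s ≟ i) ×-dec ¬? (s ≟ r))
...   | yes (s , s∈ , s≢r) = record
  { first = r ; second = s ; first∈ = r∈ ; second∈ = s∈ ; distinct = ≢-sym s≢r }
...   | no noOther = contradiction
  (degree-universal G r (strongDominating-singleton⇒universal G dom class⊆r))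
  (notUniversal r)
  where
    class⊆r : ∀ u → c u ≡ i → u ≡ r
    class⊆r u u∈ = decidable-stable (u ≟ r) (λ u≢r → noOther (u , u∈ , u≢r))

strongDomaticPartition-double≤ : ∀ {n k} (G : SimpleGraph n) →
  (∀ v → degree G v ≢ n ∸ 1) → HasStrongDomaticPartition G k → k + k ≤ n
strongDomaticPartition-double≤ {n} {k} G notUniversal (c , partition) =
  injective⇒≤ {f = member ∘ splitAt k} injective
  where
    open TwoMembers
    twoMembers : ∀ i → TwoMembers c i
    twoMembers = class-twoMembers G notUniversal partition

    member : Fin k ⊎ Fin k → Fin n
    member = [ first ∘ twoMembers , second ∘ twoMembers ]

    classOf : Fin k ⊎ Fin k → Fin k
    classOf = [ id , id ]

    member∈ : ∀ a → c (member a) ≡ classOf a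
    member∈ (inj₁ i) = first∈ (twoMembers i)
    member∈ (inj₂ i) = second∈ (twoMembers i)

    member-injective : ∀ a b → member a ≡ member b → a ≡ b
    member-injective a b eq with trans (sym (member∈ a)) (trans (cong c eq) (member∈ b))
    member-injective (inj₁ i) (inj₁ .i) eq | refl = refl
    member-injective (inj₂ i) (inj₂ .i) eq | refl = refl
    member-injective (inj₁ i) (inj₂ .i) eq | refl = contradiction eq (distinct (twoMembers i))
    member-injective (inj₂ i) (inj₁ .i) eq | refl = contradiction (sym eq) (distinct (twoMembers i))

    injective : ∀ {a b} → member (splitAt k a) ≡ member (splitAt k b) → a ≡ b
    injective {a} {b} eq = trans (sym (join-splitAt k k a))
      (trans (cong (join k k) (member-injective (splitAt k a) (splitAt k b) eq)) (join-splitAt k k b))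

-- A graph on Fin (suc n) is the row of adjacencies of vertex 0 to the other n vertices
-- together with the graph induced on them.
UpperTriangle : ℕ → Set
UpperTriangle zero    = ⊤
UpperTriangle (suc n) = Vec Bool n × UpperTriangle n

adjacency : ∀ {n} → UpperTriangle n → Fin n → Fin n → Bool
adjacency {suc n} (row , rest) zero    zero    = false
adjacency {suc n} (row , rest) zero    (suc y) = lookup row y
adjacency {suc n} (row , rest) (suc x) zero    = lookup row x
adjacency {suc n} (row , rest) (suc x) (suc y) = adjacency rest x y

adjacency-sym : ∀ {n} (u : UpperTriangle n) x y → adjacency u x y ≡ adjacency u y x
adjacency-sym {suc n} u         zero    zero    = refl
adjacency-sym {suc n} u         zero    (suc y) = refl
adjacency-sym {suc n} u         (suc x) zero    = refl
adjacency-sym {suc n} (_ , rest) (suc x) (suc y) = adjacency-sym rest x y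

adjacency-irrefl : ∀ {n} (u : UpperTriangle n) x → adjacency u x x ≡ false
adjacency-irrefl {suc n} u          zero    = refl
adjacency-irrefl {suc n} (_ , rest) (suc x) = adjacency-irrefl rest x

fromUpperTriangle : ∀ {n} → UpperTriangle n → SimpleGraph n
fromUpperTriangle u = record
  { adj = adjacency u ; symm = adjacency-sym u ; irrefl = adjacency-irrefl u }

deleteVertex₀ : ∀ {n} → SimpleGraph (suc n) → SimpleGraph n
deleteVertex₀ G = record
  { adj    = λ x y → adj G (suc x) (suc y)
  ; symm   = λ x y → symm G (suc x) (suc y)
  ; irrefl = λ x → irrefl G (suc x) }

toUpperTriangle : ∀ {n} → SimpleGraph n → UpperTriangle n
toUpperTriangle {zero}  G = tt
toUpperTriangle {suc n} G = Vec.tabulate (adj G zero ∘ suc) , toUpperTriangle (deleteVertex₀ G)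

adjacency-toUpperTriangle : ∀ {n} (G : SimpleGraph n) x y →
  adjacency (toUpperTriangle G) x y ≡ adj G x y
adjacency-toUpperTriangle {suc n} G zero    zero    = sym (irrefl G zero)
adjacency-toUpperTriangle {suc n} G zero    (suc y) = lookup∘tabulate _ y
adjacency-toUpperTriangle {suc n} G (suc x) zero    =
  trans (lookup∘tabulate _ x) (symm G zero (suc x))
adjacency-toUpperTriangle {suc n} G (suc x) (suc y) =
  adjacency-toUpperTriangle (deleteVertex₀ G) x y

∀-Vec? : ∀ {m p} {P : Vec Bool m → Set p} → Decidable P → Dec (∀ v → P v)
∀-Vec? {zero}  P? = map′ (λ { p [] → p }) (λ ∀p → ∀p []) (P? [])
∀-Vec? {suc m} P? = map′
  (λ { (pt , pf) (true ∷ v) → pt v ; (pt , pf) (false ∷ v) → pf v })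
  (λ ∀p → (λ v → ∀p (true ∷ v)) , (λ v → ∀p (false ∷ v)))
  (∀-Vec? (P? ∘ (true ∷_)) ×-dec ∀-Vec? (P? ∘ (false ∷_)))

∀-UpperTriangle? : ∀ {n p} {P : UpperTriangle n → Set p} → Decidable P → Dec (∀ u → P u)
∀-UpperTriangle? {zero}  P? = map′ (λ p _ → p) (λ ∀p → ∀p tt) (P? tt)
∀-UpperTriangle? {suc n} P? = map′ (λ ∀p → uncurry ∀p) (λ ∀p row rest → ∀p (row , rest))
  (∀-Vec? λ row → ∀-UpperTriangle? λ rest → P? (row , rest))

cubic? : ∀ {n} (G : SimpleGraph n) → Dec (Cubic G)
cubic? G = all? λ v → degree G v ℕ.≟ 3

strongDominating? : ∀ {n} (G : SimpleGraph n) {D : Fin n → Set} → Decidable D →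
  Dec (IsStrongDominating G D)
strongDominating? G D? = all? λ x → ¬? (D? x) →-dec any? λ y →
  D? y ×-dec (adj G x y Bool.≟ true) ×-dec (degree G x ℕ.≤? degree G y)

strongDomaticPartition? : ∀ {n k} (G : SimpleGraph n) (c : Fin n → Fin k) →
  Dec (IsStrongDomaticPartition G k c)
strongDomaticPartition? G c = all? λ i →
  any? (λ v → c v ≟ i) ×-dec strongDominating? G (λ v → c v ≟ i)

-- Each class of a strong domatic 3-partition of a cubic graph of order 6 has two vertices,
-- so only the 15 perfect matchings of the vertex set, listed by the class of each vertex,
-- need to be tried.
pairings : List (Vec (Fin 3) 6)
pairings =
    (# 0 ∷ # 0 ∷ # 1 ∷ # 1 ∷ # 2 ∷ # 2 ∷ [])
  ∷ (# 0 ∷ # 0 ∷ # 1 ∷ # 2 ∷ # 1 ∷ # 2 ∷ [])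
  ∷ (# 0 ∷ # 0 ∷ # 1 ∷ # 2 ∷ # 2 ∷ # 1 ∷ [])
  ∷ (# 0 ∷ # 1 ∷ # 0 ∷ # 1 ∷ # 2 ∷ # 2 ∷ [])
  ∷ (# 0 ∷ # 1 ∷ # 0 ∷ # 2 ∷ # 1 ∷ # 2 ∷ [])
  ∷ (# 0 ∷ # 1 ∷ # 0 ∷ # 2 ∷ # 2 ∷ # 1 ∷ [])
  ∷ (# 0 ∷ # 1 ∷ # 1 ∷ # 0 ∷ # 2 ∷ # 2 ∷ [])
  ∷ (# 0 ∷ # 1 ∷ # 2 ∷ # 0 ∷ # 1 ∷ # 2 ∷ [])
  ∷ (# 0 ∷ # 1 ∷ # 2 ∷ # 0 ∷ # 2 ∷ # 1 ∷ [])
  ∷ (# 0 ∷ # 1 ∷ # 1 ∷ # 2 ∷ # 0 ∷ # 2 ∷ [])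
  ∷ (# 0 ∷ # 1 ∷ # 2 ∷ # 1 ∷ # 0 ∷ # 2 ∷ [])
  ∷ (# 0 ∷ # 1 ∷ # 2 ∷ # 2 ∷ # 0 ∷ # 1 ∷ [])
  ∷ (# 0 ∷ # 1 ∷ # 1 ∷ # 2 ∷ # 2 ∷ # 0 ∷ [])
  ∷ (# 0 ∷ # 1 ∷ # 2 ∷ # 1 ∷ # 2 ∷ # 0 ∷ [])
  ∷ (# 0 ∷ # 1 ∷ # 2 ∷ # 2 ∷ # 1 ∷ # 0 ∷ [])
  ∷ []

CubicHasDomaticPairing : UpperTriangle 6 → Set
CubicHasDomaticPairing u =
  Cubic (fromUpperTriangle u) →
  Any (λ c → IsStrongDomaticPartition (fromUpperTriangle u) 3 (lookup c)) pairings

cubicHasDomaticPairing? : Decidable CubicHasDomaticPairing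
cubicHasDomaticPairing? u = cubic? G →-dec Any.any? (λ c → strongDomaticPartition? G (lookup c)) pairings
  where
    G : SimpleGraph 6
    G = fromUpperTriangle u

allCubicHasDomaticPairing : ∀ u → CubicHasDomaticPairing u
allCubicHasDomaticPairing = toWitness {a? = ∀-UpperTriangle? cubicHasDomaticPairing?} tt

cubic₆⇒strongDomaticPartition₃ : (G : SimpleGraph 6) → Cubic G → HasStrongDomaticPartition G 3
cubic₆⇒strongDomaticPartition₃ G cub =
  pull (satisfied (allCubicHasDomaticPairing (toUpperTriangle G) (cubic-resp e cub)))
  where
    e : SameEdges G (fromUpperTriangle (toUpperTriangle G))
    same-adj e x y = sym (adjacency-toUpperTriangle G x y)
    pull : ∃ (λ c → IsStrongDomaticPartition (fromUpperTriangle (toUpperTriangle G)) 3 (lookup c)) →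
           HasStrongDomaticPartition G 3
    pull (c , p) = lookup c , strongDomaticPartition-resp (sameEdges-sym e) p

double≤6⇒≤3 : ∀ k → k + k ≤ 6 → k ≤ 3
double≤6⇒≤3 0 _ = z≤n
double≤6⇒≤3 1 _ = s≤s z≤n
double≤6⇒≤3 2 _ = s≤s (s≤s z≤n)
double≤6⇒≤3 3 _ = s≤s (s≤s (s≤s z≤n))
double≤6⇒≤3 (suc (suc (suc (suc k)))) (s≤s (s≤s (s≤s (s≤s k+4+k≤2))))
  with ℕ.m+n≤o⇒n≤o k k+4+k≤2
... | s≤s (s≤s ())

theorem3p1 : (G : SimpleGraph 6) → Cubic G → StrongDomaticNumber≡ G 3
theorem3p1 G cub = cubic₆⇒strongDomaticPartition₃ G cub , λ k partition →
  double≤6⇒≤3 k (strongDomaticPartition-double≤ G noUniversalVertex partition)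
  where
    noUniversalVertex : ∀ v → degree G v ≢ 5
    noUniversalVertex v deg≡5 with trans (sym (cub v)) deg≡5
    ... | ()
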